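{- Let $X$ and $Y$ be equal-length strings that have a common CT-block-period $p\in[1,\lfloor |X|/2\rfloor]$. Then $X\approx Y$ if and only if $X[1\mathinner{.\,.} 2p]\approx Y[1\mathinner{.\,.} 2p]$.
   Context: Strings are over a totally ordered alphabet; $X[i]$ is the $i$-th character (1-indexed); $X[i\mathinner{.\,.} j]$ denotes $X[i]\cdots X[j]$. The leftmost minimum of a nonempty string $S$ is $S[t]$ for the smallest index $t$ at which the minimum value occurs. The Cartesian tree $\mathsf{CT}(S)$: empty for the empty string; otherwise a root with left subtree $\mathsf{CT}(S[1\mathinner{.\,.} t-1])$ and right subtree $\mathsf{CT}(S[t+1\mathinner{.\,.} |S|])$, where $S[t]$ is the leftmost minimum. $S\approx S'$ iff $\mathsf{CT}(S)=\mathsf{CT}(S')$. A string $S[1\mathinner{.\,.} \ell]$ has CT-border-period $p\in[1,\ell]$ iff $S[1\mathinner{.\,.} \ell-p]\approx S[p+1\mathinner{.\,.} \ell]$; it has CT-block-period $p$ iff $p$ divides $\ell$, $p$ is a CT-border-period of $S$, and the leftmost minimum of $S$ is $S[1]$ or $S[\ell]$. -}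

module Defs where

open import Level using (Level)
open import Data.Nat using (ℕ; zero; suc; _+_; _*_; _∸_; _≤_)
open import Data.Nat.Divisibility using (_∣_)
open import Data.Empty using (⊥)
open import Data.List using (List; []; _∷_; length; take; drop)
open import Data.Product using (_×_; _,_; proj₁; proj₂)
open import Data.Sum using (_⊎_)
open import Relation.Nullary using (yes; no)
open import Relation.Binary.PropositionalEquality using (_≡_)
open import Relation.Binary.Bundles using (StrictTotalOrder)

-- Shapes of binary trees (Cartesian trees carry no labels).
data Tree : Set where
  leaf : Tree
  node : Tree → Tree → Tree

module CT {c ℓ₁ ℓ₂ : Level} (O : StrictTotalOrder c ℓ₁ ℓ₂) where
  open StrictTotalOrder O using (Carrier; _<?_)

  -- minimum value and 0-based index of the LEFTMOST minimum of x ∷ xs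
  -- (a later element replaces the current minimum only if strictly smaller)
  lmin : Carrier → List Carrier → Carrier × ℕ
  lmin x [] = x , 0
  lmin x (y ∷ ys) with lmin y ys
  ... | (m , k) with m <? x
  ...   | yes _ = m , suc k
  ...   | no  _ = x , 0

  lminIndex : Carrier → List Carrier → ℕ
  lminIndex x xs = proj₂ (lmin x xs)

  -- Cartesian tree with fuel (fuel = length suffices)
  ctFuel : ℕ → List Carrier → Tree
  ctFuel _ [] = leaf
  ctFuel zero (_ ∷ _) = leaf
  ctFuel (suc n) (x ∷ xs) =
    node (ctFuel n (take (lminIndex x xs) (x ∷ xs)))
         (ctFuel n (drop (suc (lminIndex x xs)) (x ∷ xs)))

  CT : List Carrier → Tree
  CT S = ctFuel (length S) S

  _≈CT_ : List Carrier → List Carrier → Set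
  S ≈CT S' = CT S ≡ CT S'

  IsCTBorderPeriod : ℕ → List Carrier → Set
  IsCTBorderPeriod p S =
    1 ≤ p × p ≤ length S × (take (length S ∸ p) S ≈CT drop p S)

  -- leftmost minimum is S[1] or S[ℓ]  (0-based: index 0 or ℓ-1)
  LeftmostMinAtEnd : List Carrier → Set
  LeftmostMinAtEnd [] = ⊥
  LeftmostMinAtEnd (x ∷ xs) = (lminIndex x xs ≡ 0) ⊎ (lminIndex x xs ≡ length xs)

  IsCTBlockPeriod : ℕ → List Carrier → Set
  IsCTBlockPeriod p S = p ∣ length S × IsCTBorderPeriod p S × LeftmostMinAtEnd S

module Submission where

-- Positions are 0-based. Since the Cartesian tree records, recursively, where the leftmost
-- minimum of each segment sits, two strings of equal length are CT-equivalent iff they have the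
-- same pairs (i, j) with LeftmostMinIsLast, i.e. with S[j] below all of S[i..j-1]. A
-- CT-border-period p makes these pairs invariant under (i, j) ↦ (i + p, j + p), so by induction
-- on j every such pair of X is one of Y as soon as those with j < 2p are, except for pairs with
-- i < p ≤ 2p ≤ j. If the leftmost minimum of X is X[0], such pairs do not exist. If it is the
-- last element, shifting back by multiples of p shows that X[2p-1] is below all of X[0..2p-2];
-- the common prefix carries this over to Y, where it extends the pair (p, j) to (i, j).

open import Defs
open import Level using (Level; _⊔_)
open import Function.Base using (id; _∘_)
open import Function.Bundles using (_⇔_; mk⇔; Equivalence)
open import Data.Nat
  using (ℕ; zero; suc; _+_; _*_; _∸_; _≤_; _<_; z≤n; s≤s; s≤s⁻¹; z<s; >-nonZero; _≤?_; _<?_)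
open import Data.Nat.Properties
open import Data.Nat.Induction using (<-rec)
open import Data.Nat.Divisibility using (_∣_; divides)
open import Data.List using (List; []; _∷_; length; take; drop)
open import Data.List.Properties using (length-take; length-drop)
open import Data.Maybe using (Maybe; just; nothing)
open import Data.Product using (_×_; _,_; proj₁; proj₂)
open import Data.Sum using (inj₁; inj₂)
open import Data.Empty using (⊥-elim)
open import Relation.Nullary using (¬_; yes; no)
open import Relation.Binary.PropositionalEquality
open import Relation.Binary.Bundles using (StrictTotalOrder)
open import Relation.Binary.Definitions using (tri<; tri≈; tri>)

open Equivalence using (to; from)

module LeftmostMinima {c ℓ₁ ℓ₂ : Level} (O : StrictTotalOrder c ℓ₁ ℓ₂) where
  open StrictTotalOrder O using (<-respˡ-≈)
    renaming (Carrier to A; _<_ to _≺_; _<?_ to _≺?_; trans to ≺-trans; compare to ≺-compare)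
  open CT O

  infixl 10 _!_
  infix 4 _≺ᵐ_ _⊑_

  _!_ : List A → ℕ → Maybe A
  []       ! _     = nothing
  (x ∷ xs) ! zero  = just x
  (x ∷ xs) ! suc k = xs ! k

  data _≺ᵐ_ : Maybe A → Maybe A → Set (c ⊔ ℓ₂) where
    just : ∀ {x y} → x ≺ y → just x ≺ᵐ just y

  ≺ᵐ-trans : ∀ {a b d} → a ≺ᵐ b → b ≺ᵐ d → a ≺ᵐ d
  ≺ᵐ-trans (just a≺b) (just b≺d) = just (≺-trans a≺b b≺d)

  just-≺ᵐ⁻¹ : ∀ {x y} → just x ≺ᵐ just y → x ≺ y
  just-≺ᵐ⁻¹ (just x≺y) = x≺y

  ⊀ᵐ-trans : ∀ {a m x} → ¬ a ≺ᵐ just m → ¬ m ≺ x → ¬ a ≺ᵐ just x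
  ⊀ᵐ-trans {m = m} a⊀m m⊀x (just {x = a} a≺x) with ≺-compare a m
  ... | tri< a≺m _ _ = a⊀m (just a≺m)
  ... | tri≈ _ a≈m _ = m⊀x (<-respˡ-≈ a≈m a≺x)
  ... | tri> _ _ m≺a = m⊀x (≺-trans m≺a a≺x)

  LeftmostMinIsLast : List A → ℕ → ℕ → Set (c ⊔ ℓ₂)
  LeftmostMinIsLast S i j = ∀ k → i ≤ k → k < j → S ! j ≺ᵐ S ! k

  narrow : ∀ {S i i′ j} → i ≤ i′ → LeftmostMinIsLast S i j → LeftmostMinIsLast S i′ j
  narrow i≤i′ w k i′≤k k<j = w k (≤-trans i≤i′ i′≤k) k<j

  join : ∀ {S i r′ r j} → r′ ≤ r → r < j
       → LeftmostMinIsLast S i r → LeftmostMinIsLast S r′ j → LeftmostMinIsLast S i j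
  join {r′ = r′} r′≤r r<j wᵢ wⱼ k i≤k k<j with r′ ≤? k
  ... | yes r′≤k = wⱼ k r′≤k k<j
  ... | no  r′≰k = ≺ᵐ-trans (wⱼ _ r′≤r r<j) (wᵢ k i≤k (<-≤-trans (≰⇒> r′≰k) r′≤r))

  record IsLeftmostMinIndex (S : List A) (t : ℕ) : Set (c ⊔ ℓ₂) where
    field
      bound    : t < length S
      minimal  : ∀ {i} → LeftmostMinIsLast S i t
      unbeaten : ∀ {j} → t < j → ¬ (S ! j ≺ᵐ S ! t)

    blocks : ∀ {i j} → i ≤ t → t < j → ¬ LeftmostMinIsLast S i j
    blocks i≤t t<j w = unbeaten t<j (w _ i≤t t<j)

  open IsLeftmostMinIndex

  lmin-correct : ∀ x xs → (x ∷ xs) ! proj₂ (lmin x xs) ≡ just (proj₁ (lmin x xs))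
                        × IsLeftmostMinIndex (x ∷ xs) (proj₂ (lmin x xs))
  lmin-correct x [] = refl , record
    { bound = s≤s z≤n ; minimal = λ _ _ () ; unbeaten = λ { {suc _} _ () } }
  lmin-correct x (y ∷ ys) with lmin y ys | lmin-correct y ys
  ... | m , k | m-at-k , ih with m ≺? x
  ...   | yes m≺x = m-at-k , record
    { bound    = s≤s (bound ih)
    ; minimal  = minimal′
    ; unbeaten = λ { {suc _} (s≤s k<j) → unbeaten ih k<j }
    }
    where
      minimal′ : ∀ {i} → LeftmostMinIsLast (x ∷ y ∷ ys) i (suc k)
      minimal′ zero    _ _         = subst (_≺ᵐ just x) (sym m-at-k) (just m≺x)
      minimal′ (suc l) _ (s≤s l<k) = minimal ih l z≤n l<k
  ...   | no m⊀x = refl , record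
    { bound = s≤s z≤n ; minimal = λ _ _ () ; unbeaten = λ { {suc j} _ → unbeaten′ j } }
    where
      unbeaten′ : ∀ j → ¬ ((y ∷ ys) ! j ≺ᵐ just x)
      unbeaten′ j with <-cmp j k
      ... | tri< j<k _ _ = λ yⱼ≺x →
        m⊀x (just-≺ᵐ⁻¹ (≺ᵐ-trans (subst (_≺ᵐ _) m-at-k (minimal ih j z≤n j<k)) yⱼ≺x))
      ... | tri≈ _ refl _ = m⊀x ∘ just-≺ᵐ⁻¹ ∘ subst (_≺ᵐ just x) m-at-k
      ... | tri> _ _ k<j = ⊀ᵐ-trans (subst (λ b → ¬ (_ ≺ᵐ b)) m-at-k (unbeaten ih k<j)) m⊀x

  lminIndex-correct : ∀ x xs → IsLeftmostMinIndex (x ∷ xs) (lminIndex x xs)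
  lminIndex-correct x xs = proj₂ (lmin-correct x xs)

  lminIndex≤length : ∀ x xs → lminIndex x xs ≤ length xs
  lminIndex≤length x xs = s≤s⁻¹ (bound (lminIndex-correct x xs))

  !-take : ∀ a S {k} → k < a → take a S ! k ≡ S ! k
  !-take (suc a) []      _                 = refl
  !-take (suc a) (x ∷ S) {zero}  _         = refl
  !-take (suc a) (x ∷ S) {suc k} (s≤s k<a) = !-take a S k<a

  !-drop : ∀ a S k → drop a S ! k ≡ S ! (a + k)
  !-drop zero    S       k = refl
  !-drop (suc a) []      k = refl
  !-drop (suc a) (x ∷ S) k = !-drop a S k

  take-window : ∀ {a S i j} → j < a → LeftmostMinIsLast (take a S) i j ⇔ LeftmostMinIsLast S i j
  take-window {a} {S} j<a = mk⇔
    (λ w k i≤k k<j → subst₂ _≺ᵐ_ (!-take a S j<a) (!-take a S (<-trans k<j j<a)) (w k i≤k k<j))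
    (λ w k i≤k k<j → subst₂ _≺ᵐ_ (sym (!-take a S j<a)) (sym (!-take a S (<-trans k<j j<a)))
                       (w k i≤k k<j))

  drop-window : ∀ a S {i j} → LeftmostMinIsLast (drop a S) i j ⇔ LeftmostMinIsLast S (a + i) (a + j)
  drop-window a S {i} {j} = mk⇔ shift unshift
    where
      shift : LeftmostMinIsLast (drop a S) i j → LeftmostMinIsLast S (a + i) (a + j)
      shift w k a+i≤k k<a+j with k′ , refl ← m≤n⇒∃[o]m+o≡n (≤-trans (m≤m+n a i) a+i≤k) =
        subst₂ _≺ᵐ_ (!-drop a S j) (!-drop a S k′)
          (w k′ (+-cancelˡ-≤ a i k′ a+i≤k) (+-cancelˡ-< a k′ j k<a+j))
      unshift : LeftmostMinIsLast S (a + i) (a + j) → LeftmostMinIsLast (drop a S) i j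
      unshift w k i≤k k<j = subst₂ _≺ᵐ_ (sym (!-drop a S j)) (sym (!-drop a S k))
                              (w (a + k) (+-monoʳ-≤ a i≤k) (+-monoʳ-< a k<j))

  <-length-take : ∀ a (S : List A) {j} → j < length (take a S) ⇔ (j < a × j < length S)
  <-length-take a S {j} = mk⇔
    (λ j<∣take∣ → let j<a⊓n = subst (j <_) (length-take a S) j<∣take∣
                  in m<n⊓o⇒m<n a _ j<a⊓n , m<n⊓o⇒m<o a _ j<a⊓n)
    (λ (j<a , j<n) → subst (j <_) (sym (length-take a S)) (⊓-pres-m< j<a j<n))

  <-length-drop : ∀ a (S : List A) {j} → j < length (drop a S) ⇔ a + j < length S
  <-length-drop zero    S       = mk⇔ id id
  <-length-drop (suc a) []      = mk⇔ (λ ()) (λ ())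
  <-length-drop (suc a) (x ∷ S) = mk⇔ (s≤s ∘ to (<-length-drop a S)) (from (<-length-drop a S) ∘ s≤s⁻¹)

  length-take-≤ : ∀ {a} (S : List A) → a ≤ length S → length (take a S) ≡ a
  length-take-≤ {a} S a≤n = trans (length-take a S) (m≤n⇒m⊓n≡m a≤n)

  length-take-cong : ∀ a {S S′ : List A} → length S ≡ length S′ → length (take a S) ≡ length (take a S′)
  length-take-cong a {S} {S′} e rewrite length-take a S | length-take a S′ | e = refl

  length-drop-cong : ∀ a {S S′ : List A} → length S ≡ length S′ → length (drop a S) ≡ length (drop a S′)
  length-drop-cong a {S} {S′} e rewrite length-drop a S | length-drop a S′ | e = refl

  _⊑_ : List A → List A → Set (c ⊔ ℓ₂)
  S ⊑ S′ = ∀ {i j} → j < length S → LeftmostMinIsLast S i j → LeftmostMinIsLast S′ i j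

  ⊑-take : ∀ a {S S′} → S ⊑ S′ → take a S ⊑ take a S′
  ⊑-take a {S} S⊑S′ j<∣take∣ =
    let j<a , j<n = to (<-length-take a S) j<∣take∣
    in from (take-window j<a) ∘ S⊑S′ j<n ∘ to (take-window j<a)

  ⊑-drop : ∀ a {S S′} → S ⊑ S′ → drop a S ⊑ drop a S′
  ⊑-drop a {S} {S′} S⊑S′ j<∣drop∣ =
    from (drop-window a S′) ∘ S⊑S′ (to (<-length-drop a S) j<∣drop∣) ∘ to (drop-window a S)

  ⊑-from-split : ∀ {S S′ t} → IsLeftmostMinIndex S t → IsLeftmostMinIndex S′ t
               → take t S ⊑ take t S′ → drop (suc t) S ⊑ drop (suc t) S′ → S ⊑ S′
  ⊑-from-split {S} {S′} {t} min min′ left right {i} {j} j<n w with <-cmp j t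
  ... | tri< j<t _ _  =
    to (take-window j<t) (left (from (<-length-take t S) (j<t , j<n)) (from (take-window j<t) w))
  ... | tri≈ _ refl _ = minimal min′
  ... | tri> _ _ t<j with i ≤? t
  ...   | yes i≤t = ⊥-elim (blocks min i≤t t<j w)
  ...   | no  i≰t with i′ , refl ← m≤n⇒∃[o]m+o≡n (≰⇒> i≰t)
                   | j′ , refl ← m≤n⇒∃[o]m+o≡n t<j =
    to (drop-window (suc t) S′)
       (right (from (<-length-drop (suc t) S) j<n) (from (drop-window (suc t) S) w))

  ⊑⇒minIndex-≤ : ∀ {S S′ t t′} → IsLeftmostMinIndex S t → IsLeftmostMinIndex S′ t′
               → S′ ⊑ S → t′ ≤ t
  ⊑⇒minIndex-≤ min min′ S′⊑S =
    ≮⇒≥ λ t<t′ → blocks min z≤n t<t′ (S′⊑S (bound min′) (minimal min′))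

  size : Tree → ℕ
  size leaf       = 0
  size (node l r) = suc (size l + size r)

  node-injective : ∀ {l r l′ r′} → node l r ≡ node l′ r′ → l ≡ l′ × r ≡ r′
  node-injective refl = refl , refl

  module _ {f : ℕ} (x : A) (xs : List A) (∣xs∣≤f : length xs ≤ f) where
    private
      t = lminIndex x xs

    length-left≤fuel : length (take t (x ∷ xs)) ≤ f
    length-left≤fuel =
      ≤-trans (≤-reflexive (length-take-≤ (x ∷ xs) (m≤n⇒m≤1+n (lminIndex≤length x xs))))
              (≤-trans (lminIndex≤length x xs) ∣xs∣≤f)

    length-right≤fuel : length (drop t xs) ≤ f
    length-right≤fuel = ≤-trans (≤-reflexive (length-drop t xs)) (≤-trans (m∸n≤m _ t) ∣xs∣≤f)

  size-ctFuel : ∀ f S → length S ≤ f → size (ctFuel f S) ≡ length S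
  size-ctFuel f       []       _            = refl
  size-ctFuel (suc f) (x ∷ xs) (s≤s ∣xs∣≤f) = cong suc (begin
      size (ctFuel f (take t (x ∷ xs))) + size (ctFuel f (drop t xs))
    ≡⟨ cong₂ _+_ (size-ctFuel f (take t (x ∷ xs)) (length-left≤fuel x xs ∣xs∣≤f))
                 (size-ctFuel f (drop t xs) (length-right≤fuel x xs ∣xs∣≤f)) ⟩
      length (take t (x ∷ xs)) + length (drop t xs)
    ≡⟨ cong₂ _+_ (length-take-≤ (x ∷ xs) (m≤n⇒m≤1+n t≤∣xs∣)) (length-drop t xs) ⟩
      t + (length xs ∸ t)
    ≡⟨ m+[n∸m]≡n t≤∣xs∣ ⟩
      length xs ∎)
    where
      open ≡-Reasoning
      t = lminIndex x xs
      t≤∣xs∣ = lminIndex≤length x xs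

  size-ctFuel-left : ∀ f x xs → length xs ≤ f
                   → size (ctFuel f (take (lminIndex x xs) (x ∷ xs))) ≡ lminIndex x xs
  size-ctFuel-left f x xs ∣xs∣≤f =
    trans (size-ctFuel f _ (length-left≤fuel x xs ∣xs∣≤f))
          (length-take-≤ (x ∷ xs) (m≤n⇒m≤1+n (lminIndex≤length x xs)))

  ctFuel-≡⇒⊑ : ∀ f {S S′} → length S ≤ f → length S ≡ length S′
             → ctFuel f S ≡ ctFuel f S′ → S ⊑ S′
  ctFuel-≡⇒⊑ (suc f) {x ∷ xs} {y ∷ ys} (s≤s ∣xs∣≤f) ∣S∣≡∣S′∣ eq =
    ⊑-from-split (lminIndex-correct x xs) (subst (IsLeftmostMinIndex _) (sym t≡t′) (lminIndex-correct y ys))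
      (ctFuel-≡⇒⊑ f (length-left≤fuel x xs ∣xs∣≤f) (length-take-cong t ∣S∣≡∣S′∣)
         (subst (λ u → ctFuel f (take t (x ∷ xs)) ≡ ctFuel f (take u (y ∷ ys))) (sym t≡t′) left≡))
      (ctFuel-≡⇒⊑ f (length-right≤fuel x xs ∣xs∣≤f) (length-drop-cong t (suc-injective ∣S∣≡∣S′∣))
         (subst (λ u → ctFuel f (drop t xs) ≡ ctFuel f (drop u ys)) (sym t≡t′) right≡))
    where
      t = lminIndex x xs
      left≡  = proj₁ (node-injective eq)
      right≡ = proj₂ (node-injective eq)
      ∣ys∣≤f = subst (_≤ f) (suc-injective ∣S∣≡∣S′∣) ∣xs∣≤f
      t≡t′ : t ≡ lminIndex y ys
      t≡t′ = trans (sym (size-ctFuel-left f x xs ∣xs∣≤f))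
                   (trans (cong size left≡) (size-ctFuel-left f y ys ∣ys∣≤f))

  ⊑⇒ctFuel-≡ : ∀ f {S S′} → length S ≡ length S′
             → S ⊑ S′ → S′ ⊑ S → ctFuel f S ≡ ctFuel f S′
  ⊑⇒ctFuel-≡ f       {[]}     {[]}     _ _ _ = refl
  ⊑⇒ctFuel-≡ zero    {_ ∷ _}  {_ ∷ _}  _ _ _ = refl
  ⊑⇒ctFuel-≡ (suc f) {x ∷ xs} {y ∷ ys} ∣S∣≡∣S′∣ S⊑S′ S′⊑S = cong₂ node
    (trans (⊑⇒ctFuel-≡ f (length-take-cong t ∣S∣≡∣S′∣) (⊑-take t S⊑S′) (⊑-take t S′⊑S))
           (cong (λ u → ctFuel f (take u (y ∷ ys))) t≡t′))
    (trans (⊑⇒ctFuel-≡ f (length-drop-cong t (suc-injective ∣S∣≡∣S′∣))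
              (⊑-drop (suc t) {x ∷ xs} {y ∷ ys} S⊑S′) (⊑-drop (suc t) {y ∷ ys} {x ∷ xs} S′⊑S))
           (cong (λ u → ctFuel f (drop u ys)) t≡t′))
    where
      t = lminIndex x xs
      min = lminIndex-correct x xs
      min′ = lminIndex-correct y ys
      t≡t′ : t ≡ lminIndex y ys
      t≡t′ = ≤-antisym (⊑⇒minIndex-≤ min′ min S⊑S′) (⊑⇒minIndex-≤ min min′ S′⊑S)

  ≈CT⇒⊑ : ∀ {S S′} → length S ≡ length S′ → S ≈CT S′ → S ⊑ S′
  ≈CT⇒⊑ {S} {S′} e S≈S′ =
    ctFuel-≡⇒⊑ (length S) ≤-refl e (subst (λ f → ctFuel (length S) S ≡ ctFuel f S′) (sym e) S≈S′)

  ⊑⇒≈CT : ∀ {S S′} → length S ≡ length S′ → S ⊑ S′ → S′ ⊑ S → S ≈CT S′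
  ⊑⇒≈CT {S} {S′} e S⊑S′ S′⊑S =
    subst (λ f → ctFuel (length S) S ≡ ctFuel f S′) e (⊑⇒ctFuel-≡ (length S) e S⊑S′ S′⊑S)

  border-shift : ∀ {p S i j} → IsCTBorderPeriod p S → p + j < length S
               → LeftmostMinIsLast S (p + i) (p + j) ⇔ LeftmostMinIsLast S i j
  border-shift {p} {S} {i} {j} (_ , _ , border) p+j<n = mk⇔
    (to (take-window j<n∸p) ∘ tail⊑head j<∣tail∣ ∘ from (drop-window p S))
    (to (drop-window p S) ∘ head⊑tail j<∣head∣ ∘ from (take-window j<n∸p))
    where
      n = length S
      ∣head∣≡∣tail∣ : length (take (n ∸ p) S) ≡ length (drop p S)
      ∣head∣≡∣tail∣ = trans (length-take-≤ S (m∸n≤m n p)) (sym (length-drop p S))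
      head⊑tail = ≈CT⇒⊑ ∣head∣≡∣tail∣ border
      tail⊑head = ≈CT⇒⊑ (sym ∣head∣≡∣tail∣) (sym border)
      j<∣tail∣ : j < length (drop p S)
      j<∣tail∣ = from (<-length-drop p S) p+j<n
      j<n∸p : j < n ∸ p
      j<n∸p = subst (j <_) (length-drop p S) j<∣tail∣
      j<∣head∣ : j < length (take (n ∸ p) S)
      j<∣head∣ = from (<-length-take (n ∸ p) S) (j<n∸p , ≤-<-trans (m≤n+m j p) p+j<n)

  prefix-min-descends : ∀ {p S} → IsCTBorderPeriod p S → ∀ m {j} → m * p + j < length S
                      → LeftmostMinIsLast S 0 (m * p + j) → LeftmostMinIsLast S 0 j
  prefix-min-descends border zero    _ w = w
  prefix-min-descends {p} {S} border (suc m) {j} bound w =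
    prefix-min-descends border m (≤-<-trans (m≤n+m _ p) bound′)
      (to (border-shift border bound′) (narrow {S} z≤n w′))
    where
      assoc = +-assoc p (m * p) j
      bound′ = subst (_< length S) assoc bound
      w′ = subst (LeftmostMinIsLast S 0) assoc w

  start-min⇒¬crossing : ∀ {p S i j} → IsCTBorderPeriod p S → IsLeftmostMinIndex S 0
                      → i ≤ p → p < j → j < length S → ¬ LeftmostMinIsLast S i j
  start-min⇒¬crossing {p} {S} border min i≤p p<j j<n w with j′ , refl ← m≤n⇒∃[o]m+o≡n (<⇒≤ p<j) =
    blocks min z≤n 0<j′ (to (border-shift border j<n) (narrow {S} (≤-trans i≤p (m≤m+n p 0)) w))
    where
      0<j′ = +-cancelˡ-< p 0 j′ (subst (_< p + j′) (sym (+-identityʳ p)) p<j)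

  end-min⇒second-block-min : ∀ {p S} → IsCTBorderPeriod p S → p ∣ length S → 2 * p ≤ length S
                           → LeftmostMinIsLast S 0 (length S ∸ 1) → LeftmostMinIsLast S 0 (2 * p ∸ 1)
  end-min⇒second-block-min {p} {S} border (divides q n≡q*p) 2p≤n w
    with m , refl ← m≤n⇒∃[o]m+o≡n (*-cancelʳ-≤ 2 q p {{>-nonZero (proj₁ border)}}
                                                 (subst (2 * p ≤_) n≡q*p 2p≤n)) =
    prefix-min-descends border m (subst (_< length S) last≡ (∸-monoʳ-< z<s 1≤n))
                                 (subst (LeftmostMinIsLast S 0) last≡ w)
    where
      open ≡-Reasoning
      1≤2p = ≤-trans (proj₁ border) (m≤m+n p _)
      1≤n = ≤-trans 1≤2p 2p≤n
      last≡ : length S ∸ 1 ≡ m * p + (2 * p ∸ 1)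
      last≡ = begin
        length S ∸ 1         ≡⟨ cong (_∸ 1) n≡q*p ⟩
        (2 + m) * p ∸ 1      ≡⟨ cong (_∸ 1) (*-distribʳ-+ p 2 m) ⟩
        (2 * p + m * p) ∸ 1  ≡⟨ cong (_∸ 1) (+-comm (2 * p) (m * p)) ⟩
        (m * p + 2 * p) ∸ 1  ≡⟨ +-∸-assoc (m * p) 1≤2p ⟩
        m * p + (2 * p ∸ 1)  ∎

  p≤2p∸1 : ∀ {p} → 1 ≤ p → p ≤ 2 * p ∸ 1
  p≤2p∸1 {p} 1≤p = subst (p ≤_) (sym (+-∸-assoc p (≤-trans 1≤p (m≤m+n p 0)))) (m≤m+n p _)

  crossing-transfer : ∀ {p X Y i j} → IsCTBlockPeriod p X → 2 * p ≤ length X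
    → (∀ {i j} → j < 2 * p → LeftmostMinIsLast X i j → LeftmostMinIsLast Y i j)
    → i < p → 2 * p ≤ j → j < length X
    → LeftmostMinIsLast X i j → LeftmostMinIsLast Y p j → LeftmostMinIsLast Y i j
  crossing-transfer {p} {x ∷ xs} (_ , border , inj₁ t≡0) _ _ i<p 2p≤j j<n w _ =
    ⊥-elim (start-min⇒¬crossing border (subst (IsLeftmostMinIndex _) t≡0 (lminIndex-correct x xs))
              (<⇒≤ i<p) (<-≤-trans (m<m+n p (≤-trans (proj₁ border) (m≤m+n p 0))) 2p≤j) j<n w)
  crossing-transfer {p} {x ∷ xs} {Y} (p∣n , border , inj₂ t≡last) 2p≤n prefix _ 2p≤j _ _ wY =
    join {Y} (p≤2p∸1 (proj₁ border)) (<-≤-trans 2p∸1<2p 2p≤j) (narrow {Y} z≤n (prefix 2p∸1<2p wX)) wY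
    where
      2p∸1<2p = ∸-monoʳ-< z<s (≤-trans (proj₁ border) (m≤m+n p _))
      wX = end-min⇒second-block-min border p∣n 2p≤n
             (minimal (subst (IsLeftmostMinIndex _) t≡last (lminIndex-correct x xs)))

  blockPeriod-⊑ : ∀ {p X Y} → length X ≡ length Y → 2 * p ≤ length X
                → IsCTBlockPeriod p X → IsCTBorderPeriod p Y
                → take (2 * p) X ⊑ take (2 * p) Y → X ⊑ Y
  blockPeriod-⊑ {p} {X} {Y} ∣X∣≡∣Y∣ 2p≤n blockX borderY prefix⊑ {i} {j} j<n w = <-rec P step j i j<n w
    where
      borderX = proj₁ (proj₂ blockX)
      P : ℕ → Set _
      P j = ∀ i → j < length X → LeftmostMinIsLast X i j → LeftmostMinIsLast Y i j

      prefix : ∀ {i j} → j < 2 * p → LeftmostMinIsLast X i j → LeftmostMinIsLast Y i j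
      prefix j<2p = to (take-window j<2p)
                  ∘ prefix⊑ (from (<-length-take (2 * p) X) (j<2p , <-≤-trans j<2p 2p≤n))
                  ∘ from (take-window j<2p)

      shifted : ∀ {i j} → (∀ {j′} → j′ < j → P j′) → p ≤ i → p ≤ j → j < length X
              → LeftmostMinIsLast X i j → LeftmostMinIsLast Y i j
      shifted rec p≤i p≤j j<n w with i′ , refl ← m≤n⇒∃[o]m+o≡n p≤i
                                   | j′ , refl ← m≤n⇒∃[o]m+o≡n p≤j =
        from (border-shift borderY (subst (p + j′ <_) ∣X∣≡∣Y∣ j<n))
          (rec (m<n+m j′ (proj₁ borderY)) i′ (≤-<-trans (m≤n+m j′ p) j<n) (to (border-shift borderX j<n) w))

      step : ∀ j → (∀ {j′} → j′ < j → P j′) → P j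
      step j rec i j<n w with j <? 2 * p | p ≤? i
      ... | yes j<2p | _       = prefix j<2p w
      ... | no  j≮2p | yes p≤i = shifted rec p≤i p≤j j<n w
        where p≤j = ≤-trans (m≤m+n p _) (≮⇒≥ j≮2p)
      ... | no  j≮2p | no  p≰i = crossing-transfer {Y = Y} blockX 2p≤n prefix i<p 2p≤j j<n w
                                   (shifted rec ≤-refl p≤j j<n (narrow {X} (<⇒≤ i<p) w))
        where
          i<p = ≰⇒> p≰i
          2p≤j = ≮⇒≥ j≮2p
          p≤j = ≤-trans (m≤m+n p _) 2p≤j

corollary18 : {c ℓ₁ ℓ₂ : Level} (O : StrictTotalOrder c ℓ₁ ℓ₂)
    → (X Y : List (StrictTotalOrder.Carrier O)) (p : ℕ)
    → length X ≡ length Y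
    → 1 ≤ p → 2 * p ≤ length X
    → CT.IsCTBlockPeriod O p X → CT.IsCTBlockPeriod O p Y
    → (CT._≈CT_ O X Y ⇔ CT._≈CT_ O (take (2 * p) X) (take (2 * p) Y))
corollary18 O X Y p ∣X∣≡∣Y∣ _ 2p≤∣X∣ blockX blockY = mk⇔
  (λ X≈Y → ⊑⇒≈CT ∣prefixX∣≡∣prefixY∣
             (⊑-take (2 * p) (≈CT⇒⊑ ∣X∣≡∣Y∣ X≈Y))
             (⊑-take (2 * p) (≈CT⇒⊑ (sym ∣X∣≡∣Y∣) (sym X≈Y))))
  (λ prefixX≈prefixY → ⊑⇒≈CT ∣X∣≡∣Y∣
     (blockPeriod-⊑ ∣X∣≡∣Y∣ 2p≤∣X∣ blockX (proj₁ (proj₂ blockY))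
        (≈CT⇒⊑ ∣prefixX∣≡∣prefixY∣ prefixX≈prefixY))
     (blockPeriod-⊑ (sym ∣X∣≡∣Y∣) (subst (2 * p ≤_) ∣X∣≡∣Y∣ 2p≤∣X∣)
        blockY (proj₁ (proj₂ blockX))
        (≈CT⇒⊑ (sym ∣prefixX∣≡∣prefixY∣) (sym prefixX≈prefixY))))
  where
    open LeftmostMinima O
    ∣prefixX∣≡∣prefixY∣ = length-take-cong (2 * p) ∣X∣≡∣Y∣
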